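{- Let $H$ be a finite passable game form over $\{\bot,a,b,\top\}$. If $\top\ntriangleleft H$ (i.e. not $\top\lhd H$), then there exists $n$ such that $H\leq G_n$. If $\top\nleq H$, then there exists $n$ such that $H\lhd G_n$. Here $G_0=a$ and $G_{n+1}=\{a,b\mid G_n\}$.
   Context: The poset $\{\bot,a,b,\top\}$ has $\bot<a,b<\top$ with $a,b$ incomparable. Game forms over a poset $A$: atomic $[x]$ (written $x$), $x\in A$, and composite $\{L\mid R\}$ with $L,R$ nonempty sets of game forms; atomic games have no options; finite means finitely many followers (options, options of options, etc.). $G^{(L)}$ is a left option of $G$ if $G$ is composite and $G$ itself if atomic; similarly $G^{(R)}$. Mutually recursively: $G\leq H$ iff every $G^{(L)}\lhd H$ and $G\lhd H^{(R)}$ for every $H^{(R)}$; $G\lhd H$ iff some $G^R\leq H$, or $G\leq H^L$ for some $H^L$, or both are atomic $[x],[y]$ with $x\leq y$. A game form $G$ is passable if $G\lhd G$ and recursively all its options are passable. -}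

module Defs where

open import Data.Nat using (ℕ; zero; suc)
open import Data.List using (List; []; _∷_)
open import Data.List.NonEmpty using (List⁺; _∷_; toList)
open import Data.List.Relation.Unary.All using (All)
open import Data.List.Relation.Unary.Any using (Any)
open import Data.List using (_++_)

data P : Set where
  bot a b top : P

data _≤P_ : P → P → Set where
  bot≤ : ∀ {x} → bot ≤P x
  ≤top : ∀ {x} → x ≤P top
  a≤a  : a ≤P a
  b≤b  : b ≤P b

-- Being an inductive type with finite (list) option collections, every
-- inhabitant has finitely many followers, i.e. is a finite game form.
-- Option sets are given as nonempty lists (duplicates/order are irrelevant
-- for all notions below, which only quantify over options).
data Game : Set where
  atom : P → Game
  comp : List⁺ Game → List⁺ Game → Game

lefts⁽⁾ : Game → List Game
lefts⁽⁾ (atom x)   = atom x ∷ []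
lefts⁽⁾ (comp L R) = toList L

rights⁽⁾ : Game → List Game
rights⁽⁾ (atom x)   = atom x ∷ []
rights⁽⁾ (comp L R) = toList R

lefts : Game → List Game
lefts (atom x)   = []
lefts (comp L R) = toList L

rights : Game → List Game
rights (atom x)   = []
rights (comp L R) = toList R

options : Game → List Game
options G = lefts G ++ rights G

infix 4 _≤G_ _⊲_

mutual
  data _≤G_ (G H : Game) : Set where
    le : All (λ GL → GL ⊲ H) (lefts⁽⁾ G) → All (λ HR → G ⊲ HR) (rights⁽⁾ H) → G ≤G H

  data _⊲_ : Game → Game → Set where
    right≤ : ∀ {G H} → Any (λ GR → GR ≤G H) (rights G) → G ⊲ H
    ≤left  : ∀ {G H} → Any (λ HL → G ≤G HL) (lefts H) → G ⊲ H
    atom⊲  : ∀ {x y} → x ≤P y → atom x ⊲ atom y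

data Passable (G : Game) : Set where
  passable : G ⊲ G → All Passable (options G) → Passable G

Gseq : ℕ → Game
Gseq zero    = atom a
Gseq (suc n) = comp (atom a ∷ atom b ∷ []) (Gseq n ∷ [])

-- Say H is below the sequence if H ≤ G n for some n, strictly below if
-- H ⊲ G n for some n.  The sequence increases, so finitely many games
-- strictly below it are all ⊲ a common G N.  By induction on passable H we get
-- the constructive dichotomies "⊤ ⊲ H or H is below" and "⊤ ≤ H or H is
-- strictly below".  For H = {L | R}: a left option with ⊤ ≤ H^L gives ⊤ ⊲ H,
-- otherwise every H^L is strictly below; the witness of H ⊲ H (some H^R ≤ H
-- or some H ≤ H^L) either yields ⊤ ⊲ H by transitivity or makes H strictly
-- below.  With a common bound N this gives H ≤ G (N+1), whose only right
-- option is G N.  For the second dichotomy, H ≤ G n gives H ⊲ G (n+1); and if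
-- ⊤ ⊲ H then either ⊤ ⊲ H^R for all H^R, i.e. ⊤ ≤ H, or some H^R is below.
module Submission where

open import Defs
open import Data.Nat using (zero; suc; _⊔_; _≤′_; ≤′-refl; ≤′-step)
open import Data.Nat.Properties using (m≤m⊔n; m≤n⊔m; ≤⇒≤′)
open import Data.Product using (_×_; ∃-syntax; _,_; proj₁; proj₂)
open import Data.Sum using (_⊎_; inj₁; inj₂; swap; fromInj₂)
open import Data.Empty using (⊥-elim)
open import Relation.Nullary using (¬_)
open import Function using (_∘_)
open import Data.List.NonEmpty using (toList)
open import Data.List.Relation.Unary.All as All using (All; []; _∷_)
open import Data.List.Relation.Unary.All.Properties using (++⁻)
open import Data.List.Relation.Unary.Any using (Any; here; there)
open import Data.List.Relation.Unary.Any.Properties using (Any-Σ⁻ʳ)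
open import Data.List.Membership.Propositional using (find; lose)

≤P-trans : ∀ {x y z} → x ≤P y → y ≤P z → x ≤P z
≤P-trans bot≤ _    = bot≤
≤P-trans ≤top ≤top = ≤top
≤P-trans a≤a  q    = q
≤P-trans b≤b  q    = q

atom-≤G : ∀ {x y} → x ≤P y → atom x ≤G atom y
atom-≤G p = le (atom⊲ p ∷ []) (atom⊲ p ∷ [])

mutual
  ⊲-≤P-trans : ∀ {X y z} → X ⊲ atom y → y ≤P z → X ⊲ atom z
  ⊲-≤P-trans (right≤ s)  q = right≤ (≤G-≤P-trans-Any s q)
  ⊲-≤P-trans (≤left ())  q
  ⊲-≤P-trans (atom⊲ p)   q = atom⊲ (≤P-trans p q)

  ≤G-≤P-trans : ∀ {X y z} → X ≤G atom y → y ≤P z → X ≤G atom z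
  ≤G-≤P-trans (le ls (r ∷ [])) q = le (⊲-≤P-trans-All ls q) (⊲-≤P-trans r q ∷ [])

  ≤G-≤P-trans-Any : ∀ {xs y z} → Any (_≤G atom y) xs → y ≤P z → Any (_≤G atom z) xs
  ≤G-≤P-trans-Any (here p)  q = here (≤G-≤P-trans p q)
  ≤G-≤P-trans-Any (there s) q = there (≤G-≤P-trans-Any s q)

  ⊲-≤P-trans-All : ∀ {xs y z} → All (_⊲ atom y) xs → y ≤P z → All (_⊲ atom z) xs
  ⊲-≤P-trans-All []       q = []
  ⊲-≤P-trans-All (p ∷ ps) q = ⊲-≤P-trans p q ∷ ⊲-≤P-trans-All ps q

mutual
  ≤P-⊲-trans : ∀ {x y Z} → x ≤P y → atom y ⊲ Z → atom x ⊲ Z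
  ≤P-⊲-trans p (right≤ ())
  ≤P-⊲-trans p (≤left s)  = ≤left (≤P-≤G-trans-Any p s)
  ≤P-⊲-trans p (atom⊲ q)  = atom⊲ (≤P-trans p q)

  ≤P-≤G-trans : ∀ {x y Z} → x ≤P y → atom y ≤G Z → atom x ≤G Z
  ≤P-≤G-trans p (le (l ∷ []) rs) = le (≤P-⊲-trans p l ∷ []) (≤P-⊲-trans-All p rs)

  ≤P-≤G-trans-Any : ∀ {x y xs} → x ≤P y → Any (atom y ≤G_) xs → Any (atom x ≤G_) xs
  ≤P-≤G-trans-Any p (here q)  = here (≤P-≤G-trans p q)
  ≤P-≤G-trans-Any p (there s) = there (≤P-≤G-trans-Any p s)

  ≤P-⊲-trans-All : ∀ {x y xs} → x ≤P y → All (atom y ⊲_) xs → All (atom x ⊲_) xs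
  ≤P-⊲-trans-All p []       = []
  ≤P-⊲-trans-All p (q ∷ qs) = ≤P-⊲-trans p q ∷ ≤P-⊲-trans-All p qs

mutual
  ≤G-trans : ∀ {G H K} → G ≤G H → H ≤G K → G ≤G K
  ≤G-trans p@(le ls _) q@(le _ rs) = le (⊲-≤G-trans-All ls q) (≤G-⊲-trans-All p rs)

  ⊲-≤G-trans : ∀ {X Y Z} → X ⊲ Y → Y ≤G Z → X ⊲ Z
  ⊲-≤G-trans (right≤ s)              q          = right≤ (≤G-trans-Anyˡ s q)
  ⊲-≤G-trans {Y = comp _ _} (≤left s) (le ls _) = ≤G-⊲-trans-Any s ls
  ⊲-≤G-trans (atom⊲ p)               (le (l ∷ []) _) = ≤P-⊲-trans p l

  ≤G-⊲-trans : ∀ {X Y Z} → X ≤G Y → Y ⊲ Z → X ⊲ Z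
  ≤G-⊲-trans {Y = comp _ _} (le _ rs) (right≤ s) = ⊲-≤G-trans-Any rs s
  ≤G-⊲-trans p                (≤left s)        = ≤left (≤G-trans-Anyʳ p s)
  ≤G-⊲-trans (le _ (r ∷ []))  (atom⊲ q)        = ⊲-≤P-trans r q

  ⊲-≤G-trans-All : ∀ {xs H K} → All (_⊲ H) xs → H ≤G K → All (_⊲ K) xs
  ⊲-≤G-trans-All []       q = []
  ⊲-≤G-trans-All (p ∷ ps) q = ⊲-≤G-trans p q ∷ ⊲-≤G-trans-All ps q

  ≤G-⊲-trans-All : ∀ {xs G H} → G ≤G H → All (H ⊲_) xs → All (G ⊲_) xs
  ≤G-⊲-trans-All p []       = []
  ≤G-⊲-trans-All p (q ∷ qs) = ≤G-⊲-trans p q ∷ ≤G-⊲-trans-All p qs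

  ≤G-trans-Anyˡ : ∀ {xs Y Z} → Any (_≤G Y) xs → Y ≤G Z → Any (_≤G Z) xs
  ≤G-trans-Anyˡ (here p)  q = here (≤G-trans p q)
  ≤G-trans-Anyˡ (there s) q = there (≤G-trans-Anyˡ s q)

  ≤G-trans-Anyʳ : ∀ {xs X Y} → X ≤G Y → Any (Y ≤G_) xs → Any (X ≤G_) xs
  ≤G-trans-Anyʳ p (here q)  = here (≤G-trans p q)
  ≤G-trans-Anyʳ p (there s) = there (≤G-trans-Anyʳ p s)

  ≤G-⊲-trans-Any : ∀ {X ys Z} → Any (X ≤G_) ys → All (_⊲ Z) ys → X ⊲ Z
  ≤G-⊲-trans-Any (here p)  (q ∷ _)  = ≤G-⊲-trans p q
  ≤G-⊲-trans-Any (there s) (_ ∷ qs) = ≤G-⊲-trans-Any s qs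

  ⊲-≤G-trans-Any : ∀ {X ys Z} → All (X ⊲_) ys → Any (_≤G Z) ys → X ⊲ Z
  ⊲-≤G-trans-Any (p ∷ _)  (here q)  = ⊲-≤G-trans p q
  ⊲-≤G-trans-Any (_ ∷ ps) (there s) = ⊲-≤G-trans-Any ps s

Gseq-≤G-suc : ∀ n → Gseq n ≤G Gseq (suc n)
Gseq-≤G-suc zero    = le (≤left (here (atom-≤G a≤a)) ∷ []) (atom⊲ a≤a ∷ [])
Gseq-≤G-suc (suc n) =
  le (≤left (here (atom-≤G a≤a)) ∷ ≤left (there (here (atom-≤G b≤b))) ∷ [])
     (right≤ (here (Gseq-≤G-suc n)) ∷ [])

Gseq-⊲-suc : ∀ n → Gseq n ⊲ Gseq (suc n)
Gseq-⊲-suc zero    = ≤left (here (atom-≤G a≤a))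
Gseq-⊲-suc (suc n) = right≤ (here (≤G-trans (Gseq-≤G-suc n) (Gseq-≤G-suc (suc n))))

⊲-Gseq-mono : ∀ {X m n} → m ≤′ n → X ⊲ Gseq m → X ⊲ Gseq n
⊲-Gseq-mono ≤′-refl       p = p
⊲-Gseq-mono (≤′-step m≤n) p = ⊲-≤G-trans (⊲-Gseq-mono m≤n p) (Gseq-≤G-suc _)

Below StrictlyBelow : Game → Set
Below        H = ∃[ n ] (H ≤G Gseq n)
StrictlyBelow H = ∃[ n ] (H ⊲ Gseq n)

All-StrictlyBelow⇒common : ∀ {xs} → All StrictlyBelow xs → ∃[ N ] All (_⊲ Gseq N) xs
All-StrictlyBelow⇒common []             = 0 , []
All-StrictlyBelow⇒common ((m , p) ∷ ps) =
  let n , qs = All-StrictlyBelow⇒common ps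
  in  m ⊔ n , ⊲-Gseq-mono (≤⇒≤′ (m≤m⊔n m n)) p
            ∷ All.map (⊲-Gseq-mono (≤⇒≤′ (m≤n⊔m m n))) qs

All-∪⇒All⊎Any : ∀ {A : Set} {P Q : A → Set} {xs} →
                All (λ x → P x ⊎ Q x) xs → All P xs ⊎ Any Q xs
All-∪⇒All⊎Any []             = inj₁ []
All-∪⇒All⊎Any (inj₂ q ∷ _)   = inj₂ (here q)
All-∪⇒All⊎Any (inj₁ p ∷ pqs) with All-∪⇒All⊎Any pqs
... | inj₁ ps = inj₁ (p ∷ ps)
... | inj₂ qs = inj₂ (there qs)

Dichotomy : Game → Set
Dichotomy H = (atom top ⊲ H ⊎ Below H) × (atom top ≤G H ⊎ StrictlyBelow H)

atom-dichotomy : ∀ x → Dichotomy (atom x)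
atom-dichotomy bot = inj₂ (0 , atom-≤G bot≤) , inj₂ (0 , atom⊲ bot≤)
atom-dichotomy a   = inj₂ (0 , atom-≤G a≤a)  , inj₂ (0 , atom⊲ a≤a)
atom-dichotomy b   = inj₂ (2 , le (b⊲ ∷ []) (b⊲ ∷ [])) , inj₂ (1 , b⊲)
  where
  b⊲ : ∀ {n} → atom b ⊲ Gseq (suc n)
  b⊲ = ≤left (there (here (atom-≤G b≤b)))
atom-dichotomy top = inj₁ (atom⊲ ≤top) , inj₁ (atom-≤G ≤top)

module _ {L R} (dL : All Dichotomy (toList L)) (dR : All Dichotomy (toList R)) where

  private
    H : Game
    H = comp L R

  right-option-≤⇒top⊲⊎StrictlyBelow : Any (_≤G H) (toList R) → atom top ⊲ H ⊎ StrictlyBelow H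
  right-option-≤⇒top⊲⊎StrictlyBelow s with find s
  ... | x , x∈R , x≤H with proj₁ (All.lookup dR x∈R)
  ...   | inj₁ t       = inj₁ (⊲-≤G-trans t x≤H)
  ...   | inj₂ (n , q) = inj₂ (n , right≤ (lose x∈R q))

  ≤-left-option⇒top⊲⊎StrictlyBelow : Any (H ≤G_) (toList L) → atom top ⊲ H ⊎ StrictlyBelow H
  ≤-left-option⇒top⊲⊎StrictlyBelow s with find s
  ... | x , x∈L , H≤x with proj₂ (All.lookup dL x∈L)
  ...   | inj₁ t       = inj₁ (≤left (lose x∈L t))
  ...   | inj₂ (n , q) = inj₂ (n , ≤G-⊲-trans H≤x q)

  self-⊲⇒top⊲⊎StrictlyBelow : H ⊲ H → atom top ⊲ H ⊎ StrictlyBelow H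
  self-⊲⇒top⊲⊎StrictlyBelow (right≤ s) = right-option-≤⇒top⊲⊎StrictlyBelow s
  self-⊲⇒top⊲⊎StrictlyBelow (≤left s)  = ≤-left-option⇒top⊲⊎StrictlyBelow s

  top⊲⊎Below : H ⊲ H → atom top ⊲ H ⊎ Below H
  top⊲⊎Below self
    with All-∪⇒All⊎Any (All.map (swap ∘ proj₂) dL) | self-⊲⇒top⊲⊎StrictlyBelow self
  ... | inj₂ t  | _      = inj₁ (≤left t)
  ... | inj₁ _  | inj₁ t = inj₁ t
  ... | inj₁ ls | inj₂ h with All-StrictlyBelow⇒common (h ∷ ls)
  ...   | n , H⊲ ∷ ls⊲ = inj₂ (suc n , le (All.map (⊲-Gseq-mono (≤′-step ≤′-refl)) ls⊲) (H⊲ ∷ []))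

  top≤⊎StrictlyBelow : H ⊲ H → atom top ≤G H ⊎ StrictlyBelow H
  top≤⊎StrictlyBelow self with top⊲⊎Below self
  ... | inj₂ (n , H≤) = inj₂ (suc n , ≤G-⊲-trans H≤ (Gseq-⊲-suc n))
  ... | inj₁ t with All-∪⇒All⊎Any (All.map proj₁ dR)
  ...   | inj₁ ts = inj₁ (le (t ∷ []) ts)
  ...   | inj₂ rs = let n , r = Any-Σ⁻ʳ rs in inj₂ (n , right≤ r)

mutual
  passable-dichotomy : ∀ {H} → Passable H → Dichotomy H
  passable-dichotomy {atom x}   _                   = atom-dichotomy x
  passable-dichotomy {comp L R} (passable self ps) =
    let dL , dR = ++⁻ (toList L) (All-passable-dichotomy ps)
    in  top⊲⊎Below dL dR self , top≤⊎StrictlyBelow dL dR self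

  All-passable-dichotomy : ∀ {xs} → All Passable xs → All Dichotomy xs
  All-passable-dichotomy []       = []
  All-passable-dichotomy (p ∷ ps) = passable-dichotomy p ∷ All-passable-dichotomy ps

proposition4p6 : (H : Game) → Passable H →
    (¬ (atom top ⊲ H) → ∃[ n ] (H ≤G Gseq n)) ×
    (¬ (atom top ≤G H) → ∃[ n ] (H ⊲ Gseq n))
proposition4p6 H p =
  let top⊲⊎below , top≤⊎strictlyBelow = passable-dichotomy p
  in  (λ top⋪H → fromInj₂ (⊥-elim ∘ top⋪H) top⊲⊎below)
    , (λ top≰H → fromInj₂ (⊥-elim ∘ top≰H) top≤⊎strictlyBelow)
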